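{- For every unital commutative lattice-ordered monoid $M$, the algebra $M^+=\{x\in M\mid x\ge0\}$, with $+,\vee,\wedge,0,1$ restricted from $M$ and $x\ominus1=(x+(-1))\vee0$, is a positive unital commutative lattice-ordered monoid.
   Context: A commutative lattice-ordered monoid is an algebra $\langle M;+,\vee,\wedge,0\rangle$ with $\langle M;\vee,\wedge\rangle$ a distributive lattice, $\langle M;+,0\rangle$ a commutative monoid, and $+$ distributing over $\vee$ and $\wedge$. A unital commutative lattice-ordered monoid is an algebra $\langle M;+,\vee,\wedge,0,1,-1\rangle$ whose $\{+,\vee,\wedge,0\}$-reduct is a commutative lattice-ordered monoid, with $-1+1=0$, $0\le1$, and for each $x$ some $n\in\mathbb{N}$ with $(-1)+\dots+(-1)\le x\le1+\dots+1$ ($n$ summands). A positive unital commutative lattice-ordered monoid is an algebra $\langle M;+,\vee,\wedge,0,1,-\ominus1\rangle$ (arities $2,2,2,0,0,1$) whose $\{+,\vee,\wedge,0\}$-reduct is a commutative lattice-ordered monoid and such that for every $x\in M$: $x\ge0$; $(x+1)\ominus1=x$; $(x\ominus1)+1=x\vee1$; and $x\le1+\dots+1$ ($n$ summands) for some $n\in\mathbb{N}$. -}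

module Defs where

open import Level using (_⊔_)
open import Data.Nat using (ℕ; zero; suc)
open import Data.Product using (Σ; ∃; _×_; _,_; proj₁)
open import Relation.Binary.Core using (Rel)
open import Algebra.Core using (Op₁; Op₂)
open import Algebra.Structures using (IsCommutativeMonoid)
open import Algebra.Lattice.Structures using (IsDistributiveLattice)
import Algebra.Definitions as AD

module _ {a ℓ} {A : Set a} (_≈_ : Rel A ℓ) where

  LatLeq : Op₂ A → Rel A ℓ
  LatLeq _∧_ x y = (x ∧ y) ≈ x

  times : Op₂ A → A → ℕ → A → A
  times _+_ 0# zero    x = 0#
  times _+_ 0# (suc n) x = x + times _+_ 0# n x

  record IsCLMonoid (_+_ _∨_ _∧_ : Op₂ A) (0# : A) : Set (a ⊔ ℓ) where
    field
      isDistributiveLattice : IsDistributiveLattice _≈_ _∨_ _∧_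
      +-isCommutativeMonoid : IsCommutativeMonoid _≈_ _+_ 0#
      +-distrib-∨           : AD._DistributesOver_ _≈_ _+_ _∨_
      +-distrib-∧           : AD._DistributesOver_ _≈_ _+_ _∧_

  record IsUnitalCLMonoid (_+_ _∨_ _∧_ : Op₂ A) (0# 1# m1 : A) : Set (a ⊔ ℓ) where
    field
      isCLMonoid : IsCLMonoid _+_ _∨_ _∧_ 0#
      m1+1≈0     : (m1 + 1#) ≈ 0#
      0≤1        : LatLeq _∧_ 0# 1#
      bounded    : ∀ x → ∃ λ n →
                     LatLeq _∧_ (times _+_ 0# n m1) x × LatLeq _∧_ x (times _+_ 0# n 1#)

  record IsPositiveUnitalCLMonoid (_+_ _∨_ _∧_ : Op₂ A) (0# 1# : A) (_⊖1 : Op₁ A)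
         : Set (a ⊔ ℓ) where
    field
      isCLMonoid : IsCLMonoid _+_ _∨_ _∧_ 0#
      nonneg     : ∀ x → LatLeq _∧_ 0# x
      +1⊖1       : ∀ x → ((x + 1#) ⊖1) ≈ x
      ⊖1+1       : ∀ x → ((x ⊖1) + 1#) ≈ (x ∨ 1#)
      bounded    : ∀ x → ∃ λ n → LatLeq _∧_ x (times _+_ 0# n 1#)

module Cone {a ℓ} {A : Set a} (_≈_ : Rel A ℓ) (_+_ _∨_ _∧_ : Op₂ A) (0# 1# m1 : A) where

  _≤_ : Rel A ℓ
  _≤_ = LatLeq _≈_ _∧_

  Pos : Set (a ⊔ ℓ)
  Pos = Σ A (λ x → 0# ≤ x)

  _≈⁺_ : Rel Pos ℓ
  (x , _) ≈⁺ (y , _) = x ≈ y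

  ⊖1 : A → A
  ⊖1 x = (x + m1) ∨ 0#

  record Closed : Set (a ⊔ ℓ) where
    field
      0-closed : 0# ≤ 0#
      1-closed : 0# ≤ 1#
      +-closed : ∀ {x y} → 0# ≤ x → 0# ≤ y → 0# ≤ (x + y)
      ∨-closed : ∀ {x y} → 0# ≤ x → 0# ≤ y → 0# ≤ (x ∨ y)
      ∧-closed : ∀ {x y} → 0# ≤ x → 0# ≤ y → 0# ≤ (x ∧ y)
      ⊖-closed : ∀ {x} → 0# ≤ x → 0# ≤ ⊖1 x

  module Ops (cl : Closed) where
    open Closed cl
    _+⁺_ : Op₂ Pos
    (x , p) +⁺ (y , q) = x + y , +-closed p q
    _∨⁺_ : Op₂ Pos
    (x , p) ∨⁺ (y , q) = x ∨ y , ∨-closed p q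
    _∧⁺_ : Op₂ Pos
    (x , p) ∧⁺ (y , q) = x ∧ y , ∧-closed p q
    0⁺ : Pos
    0⁺ = 0# , 0-closed
    1⁺ : Pos
    1⁺ = 1# , 1-closed
    ⊖1⁺ : Op₁ Pos
    ⊖1⁺ (x , p) = ⊖1 x , ⊖-closed p

  IsPositiveCone : Set (a ⊔ ℓ)
  IsPositiveCone = Σ Closed λ cl → let open Ops cl in
    IsPositiveUnitalCLMonoid _≈⁺_ _+⁺_ _∨⁺_ _∧⁺_ 0⁺ 1⁺ ⊖1⁺

-- Every operation of M, including x ↦ (x + -1) ∨ 0, preserves 0 ≤ x, so M⁺ is a
-- subalgebra and the lattice-ordered monoid laws pull back along the inclusion.
-- Because -1 + 1 = 0, on M⁺ we get (x + 1) ⊖ 1 = x ∨ 0 = x, and distributivity of +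
-- over ∨ gives (x ⊖ 1) + 1 = ((x - 1) + 1) ∨ (0 + 1) = x ∨ 1; the bound x ≤ n·1 is
-- inherited from M.
module Submission where

open import Defs
open import Relation.Binary.Core using (Rel)
open import Algebra.Core using (Op₂)
open import Data.Nat using (zero; suc)
open import Data.Product using (∃; _,_; proj₁; proj₂)
open import Function using (id)
open import Relation.Binary.PropositionalEquality as ≡ using (_≡_)
open import Algebra.Definitions using (Congruent₂; _DistributesOver_)
open import Algebra.Morphism.Definitions using (Homomorphic₂)
open import Algebra.Morphism.Structures using (IsMonoidMonomorphism)
open import Algebra.Lattice.Bundles using (RawLattice; Lattice)
open import Algebra.Lattice.Morphism.Structures using (IsLatticeMonomorphism)
open import Algebra.Bundles using (RawMonoid)
open import Algebra.Structures using (IsCommutativeMonoid)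
open import Algebra.Lattice.Structures using (IsDistributiveLattice)
import Algebra.Morphism.MonoidMonomorphism as MonoidMonomorphism
import Algebra.Lattice.Morphism.LatticeMonomorphism as LatticeMonomorphism
import Algebra.Lattice.Properties.Lattice as LatticeProperties
import Relation.Binary.Reasoning.Setoid as ≈-Reasoning

rawLattice : ∀ {a ℓ} {A : Set a} → Rel A ℓ → Op₂ A → Op₂ A → RawLattice a ℓ
rawLattice _≈_ _∨_ _∧_ = record { _≈_ = _≈_; _∨_ = _∨_; _∧_ = _∧_ }

rawMonoid : ∀ {a ℓ} {A : Set a} → Rel A ℓ → Op₂ A → A → RawMonoid a ℓ
rawMonoid _≈_ _+_ 0# = record { _≈_ = _≈_; _∙_ = _+_; ε = 0# }

module CLMonoidMonomorphism
  {a b ℓ₁ ℓ₂} {A : Set a} {B : Set b} {_≈₁_ : Rel A ℓ₁} {_≈₂_ : Rel B ℓ₂}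
  {_+₁_ _∨₁_ _∧₁_ : Op₂ A} {0₁ : A} {_+₂_ _∨₂_ _∧₂_ : Op₂ B} {0₂ : B} {⟦_⟧ : A → B}
  (isLatticeMonomorphism : IsLatticeMonomorphism
     (rawLattice _≈₁_ _∨₁_ _∧₁_) (rawLattice _≈₂_ _∨₂_ _∧₂_) ⟦_⟧)
  (+-isMonoidMonomorphism : IsMonoidMonomorphism
     (rawMonoid _≈₁_ _+₁_ 0₁) (rawMonoid _≈₂_ _+₂_ 0₂) ⟦_⟧)
  where

  open IsMonoidMonomorphism +-isMonoidMonomorphism using (injective) renaming (homo to +-homo)
  open IsLatticeMonomorphism isLatticeMonomorphism using (∨-homo; ∧-homo)

  module _ (M : IsCLMonoid _≈₂_ _+₂_ _∨₂_ _∧₂_ 0₂) where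
    open IsCLMonoid M
    open IsCommutativeMonoid +-isCommutativeMonoid using (setoid; refl; sym; ∙-cong)
    open ≈-Reasoning setoid

    +-distrib : ∀ {_∙₁_ _∙₂_} → Homomorphic₂ A B _≈₂_ ⟦_⟧ _∙₁_ _∙₂_ → Congruent₂ _≈₂_ _∙₂_ →
                _DistributesOver_ _≈₂_ _+₂_ _∙₂_ → _DistributesOver_ _≈₁_ _+₁_ _∙₁_
    +-distrib {_∙₁_} {_∙₂_} ∙-homo ∙₂-cong (distribˡ , distribʳ) = distribˡ₁ , distribʳ₁
      where
      distribˡ₁ : ∀ x y z → (x +₁ (y ∙₁ z)) ≈₁ ((x +₁ y) ∙₁ (x +₁ z))
      distribˡ₁ x y z = injective (begin
        ⟦ x +₁ (y ∙₁ z) ⟧                   ≈⟨ +-homo x (y ∙₁ z) ⟩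
        ⟦ x ⟧ +₂ ⟦ y ∙₁ z ⟧                 ≈⟨ ∙-cong refl (∙-homo y z) ⟩
        ⟦ x ⟧ +₂ (⟦ y ⟧ ∙₂ ⟦ z ⟧)           ≈⟨ distribˡ ⟦ x ⟧ ⟦ y ⟧ ⟦ z ⟧ ⟩
        (⟦ x ⟧ +₂ ⟦ y ⟧) ∙₂ (⟦ x ⟧ +₂ ⟦ z ⟧) ≈⟨ ∙₂-cong (sym (+-homo x y)) (sym (+-homo x z)) ⟩
        ⟦ x +₁ y ⟧ ∙₂ ⟦ x +₁ z ⟧             ≈⟨ sym (∙-homo (x +₁ y) (x +₁ z)) ⟩
        ⟦ (x +₁ y) ∙₁ (x +₁ z) ⟧             ∎)

      distribʳ₁ : ∀ x y z → ((y ∙₁ z) +₁ x) ≈₁ ((y +₁ x) ∙₁ (z +₁ x))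
      distribʳ₁ x y z = injective (begin
        ⟦ (y ∙₁ z) +₁ x ⟧                   ≈⟨ +-homo (y ∙₁ z) x ⟩
        ⟦ y ∙₁ z ⟧ +₂ ⟦ x ⟧                 ≈⟨ ∙-cong (∙-homo y z) refl ⟩
        (⟦ y ⟧ ∙₂ ⟦ z ⟧) +₂ ⟦ x ⟧           ≈⟨ distribʳ ⟦ x ⟧ ⟦ y ⟧ ⟦ z ⟧ ⟩
        (⟦ y ⟧ +₂ ⟦ x ⟧) ∙₂ (⟦ z ⟧ +₂ ⟦ x ⟧) ≈⟨ ∙₂-cong (sym (+-homo y x)) (sym (+-homo z x)) ⟩
        ⟦ y +₁ x ⟧ ∙₂ ⟦ z +₁ x ⟧             ≈⟨ sym (∙-homo (y +₁ x) (z +₁ x)) ⟩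
        ⟦ (y +₁ x) ∙₁ (z +₁ x) ⟧             ∎)

    isCLMonoid : IsCLMonoid _≈₁_ _+₁_ _∨₁_ _∧₁_ 0₁
    isCLMonoid = record
      { isDistributiveLattice =
          LatticeMonomorphism.isDistributiveLattice isLatticeMonomorphism isDistributiveLattice
      ; +-isCommutativeMonoid =
          MonoidMonomorphism.isCommutativeMonoid +-isMonoidMonomorphism +-isCommutativeMonoid
      ; +-distrib-∨ = +-distrib ∨-homo ∨-cong +-distrib-∨
      ; +-distrib-∧ = +-distrib ∧-homo ∧-cong +-distrib-∧
      }
      where open IsDistributiveLattice isDistributiveLattice using (∨-cong; ∧-cong)

module CLMonoidOrder
  {a ℓ} {A : Set a} {_≈_ : Rel A ℓ} {_+_ _∨_ _∧_ : Op₂ A} {0# : A}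
  (M : IsCLMonoid _≈_ _+_ _∨_ _∧_ 0#)
  where

  open IsCLMonoid M
  open IsDistributiveLattice isDistributiveLattice
  open IsCommutativeMonoid +-isCommutativeMonoid
    using (setoid) renaming (∙-cong to +-cong; identityʳ to +-identityʳ)
  open ≈-Reasoning setoid

  lattice : Lattice a ℓ
  lattice = record { isLattice = isLattice }

  open LatticeProperties lattice using (∧-idem)

  _≤_ : Rel A ℓ
  _≤_ = LatLeq _≈_ _∧_

  ≤-refl : ∀ {x} → x ≤ x
  ≤-refl {x} = ∧-idem x

  ≤-trans : ∀ {x y z} → x ≤ y → y ≤ z → x ≤ z
  ≤-trans {x} {y} {z} x≤y y≤z = begin
    x ∧ z       ≈⟨ ∧-cong (sym x≤y) refl ⟩
    (x ∧ y) ∧ z ≈⟨ ∧-assoc x y z ⟩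
    x ∧ (y ∧ z) ≈⟨ ∧-cong refl y≤z ⟩
    x ∧ y       ≈⟨ x≤y ⟩
    x           ∎

  x≤x∨y : ∀ x y → x ≤ (x ∨ y)
  x≤x∨y = ∧-absorbs-∨

  y≤x∨y : ∀ x y → y ≤ (x ∨ y)
  y≤x∨y x y = trans (∧-cong refl (∨-comm x y)) (x≤x∨y y x)

  ∧-greatest : ∀ {x y z} → z ≤ x → z ≤ y → z ≤ (x ∧ y)
  ∧-greatest {x} {y} {z} z≤x z≤y = begin
    z ∧ (x ∧ y) ≈⟨ ∧-assoc z x y ⟨
    (z ∧ x) ∧ y ≈⟨ ∧-cong z≤x refl ⟩
    z ∧ y       ≈⟨ z≤y ⟩
    z           ∎

  ≤⇒∨≈ : ∀ {x y} → y ≤ x → (x ∨ y) ≈ x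
  ≤⇒∨≈ {x} {y} y≤x = begin
    x ∨ y       ≈⟨ ∨-cong refl (trans (sym y≤x) (∧-comm y x)) ⟩
    x ∨ (x ∧ y) ≈⟨ ∨-absorbs-∧ x y ⟩
    x           ∎

  x≤x+y : ∀ x {y} → 0# ≤ y → x ≤ (x + y)
  x≤x+y x {y} 0≤y = begin
    x ∧ (x + y)        ≈⟨ ∧-cong (sym (+-identityʳ x)) refl ⟩
    (x + 0#) ∧ (x + y) ≈⟨ proj₁ +-distrib-∧ x 0# y ⟨
    x + (0# ∧ y)       ≈⟨ +-cong refl 0≤y ⟩
    x + 0#             ≈⟨ +-identityʳ x ⟩
    x                  ∎

module UnitalCLMonoid
  {a ℓ} {A : Set a} {_≈_ : Rel A ℓ} {_+_ _∨_ _∧_ : Op₂ A} {0# 1# m1 : A}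
  (U : IsUnitalCLMonoid _≈_ _+_ _∨_ _∧_ 0# 1# m1)
  where

  open IsUnitalCLMonoid U
  open IsCLMonoid isCLMonoid
  open IsDistributiveLattice isDistributiveLattice using (∨-cong)
  open IsCommutativeMonoid +-isCommutativeMonoid
    using (setoid; refl; assoc; comm; identityˡ; identityʳ) renaming (∙-cong to +-cong)
  open ≈-Reasoning setoid
  open Cone _≈_ _+_ _∨_ _∧_ 0# 1# m1 using (⊖1)

  x+m1+1≈x : ∀ x → ((x + m1) + 1#) ≈ x
  x+m1+1≈x x = begin
    (x + m1) + 1# ≈⟨ assoc x m1 1# ⟩
    x + (m1 + 1#) ≈⟨ +-cong refl m1+1≈0 ⟩
    x + 0#        ≈⟨ identityʳ x ⟩
    x             ∎

  x+1+m1≈x : ∀ x → ((x + 1#) + m1) ≈ x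
  x+1+m1≈x x = begin
    (x + 1#) + m1 ≈⟨ assoc x 1# m1 ⟩
    x + (1# + m1) ≈⟨ +-cong refl (comm 1# m1) ⟩
    x + (m1 + 1#) ≈⟨ assoc x m1 1# ⟨
    (x + m1) + 1# ≈⟨ x+m1+1≈x x ⟩
    x             ∎

  +1⊖1≈∨0 : ∀ x → ⊖1 (x + 1#) ≈ (x ∨ 0#)
  +1⊖1≈∨0 x = ∨-cong (x+1+m1≈x x) refl

  ⊖1+1≈∨1 : ∀ x → (⊖1 x + 1#) ≈ (x ∨ 1#)
  ⊖1+1≈∨1 x = begin
    ((x + m1) ∨ 0#) + 1#        ≈⟨ proj₂ +-distrib-∨ 1# (x + m1) 0# ⟩
    ((x + m1) + 1#) ∨ (0# + 1#) ≈⟨ ∨-cong (x+m1+1≈x x) (identityˡ 1#) ⟩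
    x ∨ 1#                      ∎

module PositiveCone
  {a ℓ} {A : Set a} {_≈_ : Rel A ℓ} {_+_ _∨_ _∧_ : Op₂ A} {0# 1# m1 : A}
  (U : IsUnitalCLMonoid _≈_ _+_ _∨_ _∧_ 0# 1# m1)
  where

  open IsUnitalCLMonoid U
  open IsCLMonoid isCLMonoid using (isDistributiveLattice)
  open IsDistributiveLattice isDistributiveLattice using (refl; trans)
  open CLMonoidOrder isCLMonoid
  open UnitalCLMonoid U
  open Cone _≈_ _+_ _∨_ _∧_ 0# 1# m1 using (_≈⁺_; Closed; module Ops)

  closed : Closed
  closed = record
    { 0-closed = ≤-refl
    ; 1-closed = 0≤1
    ; +-closed = λ {x} 0≤x 0≤y → ≤-trans 0≤x (x≤x+y x 0≤y)
    ; ∨-closed = λ {x} {y} 0≤x _ → ≤-trans 0≤x (x≤x∨y x y)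
    ; ∧-closed = ∧-greatest
    ; ⊖-closed = λ {x} _ → y≤x∨y (x + m1) 0#
    }

  open Ops closed

  proj₁-isLatticeMonomorphism :
    IsLatticeMonomorphism (rawLattice _≈⁺_ _∨⁺_ _∧⁺_) (rawLattice _≈_ _∨_ _∧_) proj₁
  proj₁-isLatticeMonomorphism = record
    { isLatticeHomomorphism = record
      { isRelHomomorphism = record { cong = id }
      ; ∧-homo = λ _ _ → refl
      ; ∨-homo = λ _ _ → refl
      }
    ; injective = id
    }

  proj₁-isMonoidMonomorphism :
    IsMonoidMonomorphism (rawMonoid _≈⁺_ _+⁺_ 0⁺) (rawMonoid _≈_ _+_ 0#) proj₁
  proj₁-isMonoidMonomorphism = record
    { isMonoidHomomorphism = record
      { isMagmaHomomorphism = record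
        { isRelHomomorphism = record { cong = id }
        ; homo = λ _ _ → refl
        }
      ; ε-homo = refl
      }
    ; injective = id
    }

  proj₁-times : ∀ n x → proj₁ (times _≈⁺_ _+⁺_ 0⁺ n x) ≡ times _≈_ _+_ 0# n (proj₁ x)
  proj₁-times zero    x = ≡.refl
  proj₁-times (suc n) x = ≡.cong (proj₁ x +_) (proj₁-times n x)

  isPositiveUnitalCLMonoid : IsPositiveUnitalCLMonoid _≈⁺_ _+⁺_ _∨⁺_ _∧⁺_ 0⁺ 1⁺ ⊖1⁺
  isPositiveUnitalCLMonoid = record
    { isCLMonoid = CLMonoidMonomorphism.isCLMonoid
        proj₁-isLatticeMonomorphism proj₁-isMonoidMonomorphism isCLMonoid
    ; nonneg     = proj₂
    ; +1⊖1       = λ { (x , 0≤x) → trans (+1⊖1≈∨0 x) (≤⇒∨≈ 0≤x) }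
    ; ⊖1+1       = λ x → ⊖1+1≈∨1 (proj₁ x)
    ; bounded    = bounded⁺
    }
    where
    bounded⁺ : ∀ x → ∃ λ n → LatLeq _≈⁺_ _∧⁺_ x (times _≈⁺_ _+⁺_ 0⁺ n 1⁺)
    bounded⁺ (x , _) with bounded x
    ... | n , _ , x≤n1 = n , ≡.subst (λ t → (x ∧ t) ≈ x) (≡.sym (proj₁-times n 1⁺)) x≤n1

proposition4p4 : ∀ {a ℓ} {A : Set a} (_≈_ : Rel A ℓ) (_+_ _∨_ _∧_ : Op₂ A) (0# 1# m1 : A) →
    IsUnitalCLMonoid _≈_ _+_ _∨_ _∧_ 0# 1# m1 →
    Cone.IsPositiveCone _≈_ _+_ _∨_ _∧_ 0# 1# m1
proposition4p4 _ _ _ _ _ _ _ U = closed , isPositiveUnitalCLMonoid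
  where open PositiveCone U
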